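{- Let $n$, $t$, $s$ be positive integers with $n\geq t+s+2$, and let $\mathcal{F}\subseteq\binom{[n]}{t+1}$ be an $s$-almost $t$-intersecting family which is not $t$-intersecting and which has maximum size among all such families. Let $A,B\in\mathcal{F}$ with $A\setminus B=\{1,2\}$ and $B\setminus A=\{3,4\}$. Then: (i) suppose $\mathcal{F}\cap \mathcal{E}=\mathcal{E}$; if $X_{i,x}\in \mathcal{F}$ for some $(i,x)\in [4]\times ([n]\setminus [4])$, then $$\sum_{j\in[4]\setminus\{i\}} |\mathcal{F}\cap \mathcal{G}_{j}|\leq s-3+\left|\mathcal{F}\cap\{X_{j,x}:j\in[4]\setminus\{i\}\}\right|\leq s;$$ (ii) suppose $\mathcal{F}\cap\mathcal{E}=\mathcal{E}\setminus \{X_{2,4}\}$; if $X_{i,x}\in \mathcal{F}$ for some $(i,x)\in [4]\times ([n]\setminus [4])$, then $$\sum_{j\in[4]\setminus\{i\}} |\mathcal{F}\cap \mathcal{G}_{j}|\leq s-2+\left|\mathcal{F}\cap\{X_{j,x}:j\in[4]\setminus\{i\}\}\right|,$$ and moreover, if $(i,x)\in I$, then $$\sum_{j\in[4]\setminus\{i\}} |\mathcal{F}\cap \mathcal{G}_{j}|\leq s-3+\left|\mathcal{F}\cap\{X_{j,x}:j\in[4]\setminus\{i\}\}\right|.$$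
   Context: $\mathcal{F}$ is $s$-almost $t$-intersecting if $\left|\{F'\in\mathcal{F}: |F'\cap F|<t\}\right|\leq s$ for every $F\in\mathcal{F}$; $t$-intersecting if any two members share at least $t$ elements. Here $|A|=|B|=t+1$, $|A\cap B|=t-1$. For $i\in[4]$ and $x\in[n]\setminus\{i\}$ put $X_{i,x}=(A\cap B)\cup\{i,x\}$ if $x\notin A\cap B$, and $X_{i,x}=(A\cup B)\setminus\{i,x\}$ if $x\in A\cap B$. Set $\mathcal{E}=\{X_{i,x}:\{i,x\}\in\binom{[4]}{2}\}$, $\mathcal{G}_i=\{X_{i,x}: x\in[n]\setminus[4]\}$ for $i\in[4]$, and $I=(\{1,3\}\times (A\cap B))\cup(\{2,4\}\times([n]\setminus(A\cup B)))$. -}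

module Defs where

open import Data.Nat using (ℕ; zero; suc; _+_; _≤_; _<_; _<?_; _≤?_; s≤s; z≤n)
open import Data.Nat.Properties using (≤-trans; +-mono-≤; m≤m+n)
open import Data.Bool using (Bool; true; false; if_then_else_)
import Data.Bool.Properties as BoolP
open import Data.Fin using (Fin; toℕ; inject≤)
open import Data.Fin.Properties using (any?) renaming (_≟_ to _≟ᶠ_)
open import Data.Fin.Subset using (Subset; _∩_; _∪_; _─_; ⁅_⁆; ∣_∣)
open import Data.Vec using (lookup; allFin)
open import Data.Vec.Properties using (≡-dec)
open import Data.List using (List; length; filter; map)
open import Data.Nat.ListAction using (sum)
import Data.Vec as Vec
open import Data.List.Membership.Propositional using () renaming (_∈_ to _∈ₗ_; _∉_ to _∉ₗ_) public
open import Data.List.Relation.Unary.All using (All)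
open import Data.List.Relation.Unary.Unique.Propositional using (Unique)
open import Data.Product using (_×_; _,_; ∃)
open import Relation.Nullary using (¬_; ¬?)
open import Relation.Nullary.Decidable using (_×-dec_)
open import Relation.Binary.PropositionalEquality using (_≡_; _≢_)
open import Relation.Binary.Definitions using (DecidableEquality)

_≟ₛ_ : {n : ℕ} → DecidableEquality (Subset n)
_≟ₛ_ = ≡-dec BoolP._≟_

four≤n : {n t s : ℕ} → 1 ≤ t → 1 ≤ s → t + s + 2 ≤ n → 4 ≤ n
four≤n {n} {t} {s} ht hs h = ≤-trans (+-mono-≤ (+-mono-≤ ht hs) (Data.Nat.Properties.≤-refl {2})) h

badCount : {n : ℕ} → ℕ → List (Subset n) → Subset n → ℕ
badCount t 𝓕 F = length (filter (λ F' → ∣ F' ∩ F ∣ <? t) 𝓕)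

AlmostIntersecting : {n : ℕ} → ℕ → ℕ → List (Subset n) → Set
AlmostIntersecting s t 𝓕 = ∀ {F} → F ∈ₗ 𝓕 → badCount t 𝓕 F ≤ s

Intersecting : {n : ℕ} → ℕ → List (Subset n) → Set
Intersecting t 𝓕 = ∀ {F F'} → F ∈ₗ 𝓕 → F' ∈ₗ 𝓕 → t ≤ ∣ F ∩ F' ∣

Admissible : {n : ℕ} → ℕ → ℕ → List (Subset n) → Set
Admissible t s 𝓕 =
  Unique 𝓕 × All (λ F → ∣ F ∣ ≡ suc t) 𝓕 × AlmostIntersecting s t 𝓕 × ¬ Intersecting t 𝓕

MaxAdmissible : (n : ℕ) → ℕ → ℕ → List (Subset n) → Set
MaxAdmissible n t s 𝓕 =
  Admissible t s 𝓕 × (∀ (𝓖 : List (Subset n)) → Admissible t s 𝓖 → length 𝓖 ≤ length 𝓕)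

-- The sets X_{i,x}, G_i, I.  Element k+1 of [4] is ι k (0-based Fin 4).

module Setup {n : ℕ} (le : 4 ≤ n) (A B : Subset n) where

  ι : Fin 4 → Fin n
  ι i = inject≤ i le

  Outside4 : Fin n → Set
  Outside4 x = 4 ≤ toℕ x

  X : Fin 4 → Fin n → Subset n
  X i x = if lookup (A ∩ B) x
          then (A ∪ B) ─ (⁅ ι i ⁆ ∪ ⁅ x ⁆)
          else (A ∩ B) ∪ (⁅ ι i ⁆ ∪ ⁅ x ⁆)

  countG : List (Subset n) → Fin 4 → ℕ
  countG 𝓕 j = length (filter (λ S → any? (λ x → (4 ≤? toℕ x) ×-dec (S ≟ₛ X j x))) 𝓕)

  sumOthers : List (Subset n) → Fin 4 → ℕ
  sumOthers 𝓕 i = sum (map (countG 𝓕) (filter (λ j → ¬? (j ≟ᶠ i)) (Vec.toList (allFin 4))))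

  countX : List (Subset n) → Fin 4 → Fin n → ℕ
  countX 𝓕 i x = length (filter (λ S → any? (λ j → (¬? (j ≟ᶠ i)) ×-dec (S ≟ₛ X j x))) 𝓕)

  -- (i,x) ∈ I = ({1,3} × (A∩B)) ∪ ({2,4} × ([n] ∖ (A∪B)))   (0-based: {0,2} and {1,3})
  open import Data.Fin.Subset using (_∈_; _∉_)
  open import Data.Sum using (_⊎_)
  InI : Fin 4 → Fin n → Set
  InI i x = ((i ≡ Fin.zero ⊎ i ≡ Fin.suc (Fin.suc Fin.zero)) × x ∈ (A ∩ B))
          ⊎ ((i ≡ Fin.suc Fin.zero ⊎ i ≡ Fin.suc (Fin.suc (Fin.suc Fin.zero))) × x ∉ (A ∪ B))
    where import Data.Fin as Fin

{-# OPTIONS --safe #-}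
module Submission where

-- Fix X_{i,x} ∈ 𝓕 with x ∉ [4] and put C = A ∩ B, so that A = C ∪ {1,2}, B = C ∪ {3,4} and
-- |C| = t - 1. Every X_{j,y} with j ≠ i and x ≠ y ∉ [4] meets X_{i,x} in t - 1 points, and so
-- does every edge set X_{k,l} = C ∪ {k,l} through i if x ∈ C, resp. avoiding i if x ∉ C; there
-- are three such edges. These sets are pairwise distinct, so at most s of them lie in 𝓕, and
-- the other members of 𝓕 ∩ 𝓖_j (j ≠ i) are the sets X_{j,x}. Hence
-- Σ_{j ≠ i} |𝓕 ∩ 𝓖_j| + #(bad edge sets in 𝓕) ≤ s + |𝓕 ∩ {X_{j,x} : j ≠ i}|. In case (ii)
-- only X_{2,4} is missing from 𝓕, and it is not bad when (i,x) ∈ I.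
--
-- All set computations are pointwise: an element of [n] is a corner or lies outside [4], where
-- its membership in each set involved depends only on whether it lies in C and whether it is
-- x or y. So each bound |P| < t and each separation of two X's at a corner is a finite Boolean
-- check, decided by evaluation.

open import Data.Bool using (Bool; true; false; _∧_; _∨_; not; _xor_; T)
import Data.Bool.Properties as Bool
open import Data.Fin using (Fin; zero; suc; #_; toℕ)
open import Data.Fin.Properties using (_≟_; all?; any?; inject≤-injective; toℕ-inject≤; toℕ<n)
open import Data.Fin.Subset using (Subset; _∩_; _∪_; _─_; ⁅_⁆; ∣_∣; _∉_)
open import Data.Fin.Subset.Properties using (∣⁅x⁆∣≡1; p∩q⊆p; p⊆p∪q)
open import Data.List using (List; []; _∷_; _++_; map; filter; length; allFin; tabulate)
open import Data.List.Properties using (filter-none; filter-some; map-++; map-∘; map-cong; map-tabulate)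
open import Data.List.Membership.Propositional using (_∈_)
open import Data.List.Membership.Propositional.Properties using (∈-filter⁺; ∈-allFin)
open import Data.List.Relation.Unary.All using (All; []; _∷_)
import Data.List.Relation.Unary.All as All
import Data.List.Relation.Unary.All.Properties as AllP
open import Data.List.Relation.Unary.AllPairs using (AllPairs; []; _∷_; allPairs?)
import Data.List.Relation.Unary.AllPairs as AllPairs
import Data.List.Relation.Unary.AllPairs.Properties as AllPairsP
open import Data.List.Relation.Unary.Any using (Any; here; there)
import Data.List.Relation.Unary.Any as Any
open import Data.List.Relation.Unary.Unique.Propositional using (Unique)
open import Data.List.Relation.Unary.Unique.Propositional.Properties using (allFin⁺)
import Data.Nat as ℕ
open import Data.Nat using (ℕ; zero; suc; _+_; _≤_; _<_; _≤?_; _<?_; z≤n; s≤s; s≤s⁻¹)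
open import Data.Nat.ListAction using (sum)
open import Data.Nat.ListAction.Properties using (sum-++)
open import Data.Nat.Properties hiding (_≟_)
open import Algebra.Properties.CommutativeSemigroup +-commutativeSemigroup using (interchange)
open import Data.Product using (_×_; _,_; ∃; proj₁; proj₂; swap)
open import Data.Sum using (_⊎_; inj₁; inj₂)
open import Data.Unit using (⊤; tt)
import Data.Vec as Vec
open import Data.Vec using (lookup)
open import Data.Vec.Properties using (lookup-zipWith; lookup-replicate; []=⇒lookup; lookup⇒[]=)
open import Function using (_∘_; id)
open import Function.Bundles using (_⇔_; Equivalence)
open import Level using (Level; 0ℓ)
open import Relation.Binary.Definitions using (DecidableEquality)
open import Relation.Binary.PropositionalEquality
open import Relation.Nullary using (¬_; Dec; yes; no; does; contradiction; ¬?)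
open import Relation.Nullary.Decidable using (dec-true; dec-false; map′; T?; _×-dec_; _→-dec_; from-yes)
open import Relation.Unary using (Pred; Decidable; _⊥_)
import Relation.Unary as U
open import Relation.Unary.Properties using (_∪?_)

open import Defs

private variable
  a b p q r : Level
  A K : Set a

-- Counting in lists

χ : Bool → ℕ
χ true  = 1
χ false = 0

sum-map-+ : ∀ (f g : A → ℕ) xs → sum (map (λ x → f x + g x) xs) ≡ sum (map f xs) + sum (map g xs)
sum-map-+ f g []       = refl
sum-map-+ f g (x ∷ xs) = trans (cong (f x + g x +_) (sum-map-+ f g xs)) (interchange (f x) (g x) _ _)

sum-map-mono : ∀ {f g : A → ℕ} → (∀ x → f x ≤ g x) → ∀ xs → sum (map f xs) ≤ sum (map g xs)
sum-map-mono f≤g []       = z≤n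
sum-map-mono f≤g (x ∷ xs) = +-mono-≤ (f≤g x) (sum-map-mono f≤g xs)

length≤sum-map : ∀ {f : A → ℕ} {xs} → All (λ x → 1 ≤ f x) xs → length xs ≤ sum (map f xs)
length≤sum-map []             = z≤n
length≤sum-map (1≤fx ∷ 1≤fxs) = +-mono-≤ 1≤fx (length≤sum-map 1≤fxs)

sum-map≤length : ∀ {f : A → ℕ} → (∀ x → f x ≤ 1) → ∀ xs → sum (map f xs) ≤ length xs
sum-map≤length f≤1 []       = z≤n
sum-map≤length f≤1 (x ∷ xs) = +-mono-≤ (f≤1 x) (sum-map≤length f≤1 xs)

sum-map-swap : ∀ {B : Set b} (f : A → B → ℕ) xs ys →
  sum (map (λ x → sum (map (f x) ys)) xs) ≡ sum (map (λ y → sum (map (λ x → f x y) xs)) ys)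
sum-map-swap f []       ys = sym (sum-zeros ys)
  where
  sum-zeros : ∀ ys → sum (map (λ _ → 0) ys) ≡ 0
  sum-zeros []       = refl
  sum-zeros (_ ∷ ys) = sum-zeros ys
sum-map-swap f (x ∷ xs) ys =
  trans (cong (sum (map (f x) ys) +_) (sum-map-swap f xs ys))
        (sym (sum-map-+ (f x) (λ y → sum (map (λ x → f x y) xs)) ys))

length-filter≡sum-χ : ∀ {P : Pred A p} (P? : Decidable P) xs →
                      length (filter P? xs) ≡ sum (map (χ ∘ does ∘ P?) xs)
length-filter≡sum-χ P? []       = refl
length-filter≡sum-χ P? (x ∷ xs) with does (P? x)
... | true  = cong suc (length-filter≡sum-χ P? xs)
... | false = length-filter≡sum-χ P? xs

length-filter-∪ : ∀ {R : Pred A q} {Q : Pred A r} (R? : Decidable R) (Q? : Decidable Q) xs →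
                  length (filter (R? ∪? Q?) xs) ≤ length (filter R? xs) + length (filter Q? xs)
length-filter-∪ R? Q? []       = z≤n
length-filter-∪ R? Q? (x ∷ xs) with ih ← length-filter-∪ R? Q? xs | does (R? x) | does (Q? x)
... | true  | true  = s≤s (≤-trans ih (+-monoʳ-≤ _ (n≤1+n _)))
... | true  | false = s≤s ih
... | false | true  = ≤-trans (s≤s ih) (≤-reflexive (sym (+-suc _ _)))
... | false | false = ih

unique⇒count≡≤1 : (_≟ᴬ_ : DecidableEquality A) → ∀ {xs} → Unique xs → ∀ a →
                  length (filter (a ≟ᴬ_) xs) ≤ 1
unique⇒count≡≤1 _≟ᴬ_ []                   a = z≤n
unique⇒count≡≤1 _≟ᴬ_ {x ∷ _} (x∉xs ∷ uniq) a with a ≟ᴬ x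
... | yes refl = s≤s (≤-reflexive (cong length (filter-none (a ≟ᴬ_) x∉xs)))
... | no  _    = unique⇒count≡≤1 _≟ᴬ_ uniq a

module _ {P : K → Pred A p} (P? : ∀ k → Decidable (P k)) {S : Pred A q} (S? : Decidable S) where

  private
    Σχ : List K → A → ℕ
    Σχ ks x = sum (map (λ k → χ (does (P? k x))) ks)

    Σχ≡0 : ∀ {ks x} → All (λ k → ¬ P k x) ks → Σχ ks x ≡ 0
    Σχ≡0 []                        = refl
    Σχ≡0 {k ∷ _} {x} (¬Pkx ∷ ¬Pks) with P? k x
    ... | yes Pkx = contradiction Pkx ¬Pkx
    ... | no  _   = Σχ≡0 ¬Pks

    Σχ≤χ-disjoint : ∀ {ks} → AllPairs (λ k l → P k ⊥ P l) ks → All (λ k → P k U.⊆ S) ks →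
                    ∀ x → Σχ ks x ≤ χ (does (S? x))
    Σχ≤χ-disjoint []                    []             x = z≤n
    Σχ≤χ-disjoint {k ∷ _} (k⊥ks ∷ disj) (Pk⊆S ∷ Ps⊆S) x with P? k x
    ... | no  _   = Σχ≤χ-disjoint disj Ps⊆S x
    ... | yes Pkx with S? x
    ...   | no ¬Sx = contradiction (Pk⊆S Pkx) ¬Sx
    ...   | yes _  = s≤s (≤-reflexive (Σχ≡0 (All.map (λ k⊥l Plx → k⊥l (Pkx , Plx)) k⊥ks)))

    Σχ-any : ∀ {ks x} → Any (λ k → P k x) ks → 1 ≤ Σχ ks x
    Σχ-any {k ∷ _} {x} (here Pkx) rewrite dec-true (P? k x) Pkx = s≤s z≤n
    Σχ-any {k ∷ _}     (there any) = ≤-trans (Σχ-any any) (m≤n+m _ _)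

    χ≤Σχ-cover : ∀ {ks} → S U.⊆ (λ x → Any (λ k → P k x) ks) → ∀ x → χ (does (S? x)) ≤ Σχ ks x
    χ≤Σχ-cover S⊆⋃P x with S? x
    ... | no  _  = z≤n
    ... | yes Sx = Σχ-any (S⊆⋃P Sx)

    Σcount≡sum-Σχ : ∀ ks xs → sum (map (λ k → length (filter (P? k) xs)) ks) ≡ sum (map (Σχ ks) xs)
    Σcount≡sum-Σχ ks xs =
      trans (cong sum (map-cong (λ k → length-filter≡sum-χ (P? k) xs) ks))
            (sum-map-swap (λ k x → χ (does (P? k x))) ks xs)

  Σcount≤count-disjoint : ∀ {ks} → AllPairs (λ k l → P k ⊥ P l) ks → All (λ k → P k U.⊆ S) ks → ∀ xs →
                          sum (map (λ k → length (filter (P? k) xs)) ks) ≤ length (filter S? xs)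
  Σcount≤count-disjoint {ks} disj Ps⊆S xs = begin
    sum (map (λ k → length (filter (P? k) xs)) ks) ≡⟨ Σcount≡sum-Σχ ks xs ⟩
    sum (map (Σχ ks) xs)                           ≤⟨ sum-map-mono (Σχ≤χ-disjoint disj Ps⊆S) xs ⟩
    sum (map (χ ∘ does ∘ S?) xs)                   ≡⟨ length-filter≡sum-χ S? xs ⟨
    length (filter S? xs)                          ∎
    where open ≤-Reasoning

  count≤Σcount-cover : ∀ {ks} → S U.⊆ (λ x → Any (λ k → P k x) ks) → ∀ xs →
                       length (filter S? xs) ≤ sum (map (λ k → length (filter (P? k) xs)) ks)
  count≤Σcount-cover {ks} S⊆⋃P xs = begin
    length (filter S? xs)                          ≡⟨ length-filter≡sum-χ S? xs ⟩
    sum (map (χ ∘ does ∘ S?) xs)                   ≤⟨ sum-map-mono (χ≤Σχ-cover S⊆⋃P) xs ⟩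
    sum (map (Σχ ks) xs)                           ≡⟨ Σcount≡sum-Σχ ks xs ⟨
    sum (map (λ k → length (filter (P? k) xs)) ks) ∎
    where open ≤-Reasoning

-- Subsets as Boolean vectors

lookup-∩ : ∀ {n} (p q : Subset n) z → lookup (p ∩ q) z ≡ lookup p z ∧ lookup q z
lookup-∩ p q z = lookup-zipWith _∧_ z p q

lookup-∪ : ∀ {n} (p q : Subset n) z → lookup (p ∪ q) z ≡ lookup p z ∨ lookup q z
lookup-∪ p q z = lookup-zipWith _∨_ z p q

lookup-─ : ∀ {n} (p q : Subset n) z → lookup (p ─ q) z ≡ lookup p z ∧ not (lookup q z)
lookup-─ (a Vec.∷ p) (true  Vec.∷ q) zero    = sym (Bool.∧-zeroʳ a)
lookup-─ (a Vec.∷ p) (false Vec.∷ q) zero    = sym (Bool.∧-identityʳ a)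
lookup-─ (a Vec.∷ p) (b     Vec.∷ q) (suc z) = lookup-─ p q z

lookup-⁅⁆ : ∀ {n} (i z : Fin n) → lookup ⁅ i ⁆ z ≡ does (i ≟ z)
lookup-⁅⁆ zero    zero    = refl
lookup-⁅⁆ zero    (suc z) = lookup-replicate z false
lookup-⁅⁆ (suc i) zero    = refl
lookup-⁅⁆ (suc i) (suc z) = lookup-⁅⁆ i z

lookup-⁅⁆∪⁅⁆ : ∀ {n} (a b z : Fin n) → lookup (⁅ a ⁆ ∪ ⁅ b ⁆) z ≡ does (a ≟ z) ∨ does (b ≟ z)
lookup-⁅⁆∪⁅⁆ a b z = trans (lookup-∪ ⁅ a ⁆ ⁅ b ⁆ z) (cong₂ _∨_ (lookup-⁅⁆ a z) (lookup-⁅⁆ b z))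

lookup-─≡⁅⁆∪⁅⁆ : ∀ {n} {p q : Subset n} {a b} → p ─ q ≡ ⁅ a ⁆ ∪ ⁅ b ⁆ →
                 ∀ z → lookup p z ∧ not (lookup q z) ≡ does (a ≟ z) ∨ does (b ≟ z)
lookup-─≡⁅⁆∪⁅⁆ {p = p} {q} {a} {b} p─q z =
  trans (sym (lookup-─ p q z)) (trans (cong (λ S → lookup S z) p─q) (lookup-⁅⁆∪⁅⁆ a b z))

∉p∪q⇒lookup-p∩q≡false : ∀ {n} (p q : Subset n) {x} → x ∉ p ∪ q → lookup (p ∩ q) x ≡ false
∉p∪q⇒lookup-p∩q≡false p q {x} x∉p∪q with lookup (p ∩ q) x in x∈p∩q
... | true  = contradiction (p⊆p∪q q (p∩q⊆p p q (lookup⇒[]= x (p ∩ q) x∈p∩q))) x∉p∪q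
... | false = refl

∣p∣≡sum-χ : ∀ {n} (p : Subset n) → ∣ p ∣ ≡ sum (map (χ ∘ lookup p) (allFin n))
∣p∣≡sum-χ Vec.[]            = refl
∣p∣≡sum-χ {suc n} (b Vec.∷ p) = begin
  ∣ b Vec.∷ p ∣                                       ≡⟨ ∣b∷p∣ b ⟩
  χ b + ∣ p ∣                                         ≡⟨ cong (χ b +_) (∣p∣≡sum-χ p) ⟩
  χ b + sum (map (χ ∘ lookup p) (allFin n))
    ≡⟨ cong (λ zs → χ b + sum zs) (map-tabulate id (χ ∘ lookup p)) ⟩
  χ b + sum (tabulate (χ ∘ lookup p))
    ≡⟨ cong (λ zs → χ b + sum zs) (map-tabulate suc (χ ∘ lookup (b Vec.∷ p))) ⟨
  sum (map (χ ∘ lookup (b Vec.∷ p)) (allFin (suc n))) ∎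
  where
  open ≡-Reasoning
  ∣b∷p∣ : ∀ b → ∣ b Vec.∷ p ∣ ≡ χ b + ∣ p ∣
  ∣b∷p∣ true  = refl
  ∣b∷p∣ false = refl

sum-∣∣-mono : ∀ {n} (ps qs : List (Subset n)) →
  (∀ z → sum (map (λ p → χ (lookup p z)) ps) ≤ sum (map (λ q → χ (lookup q z)) qs)) →
  sum (map ∣_∣ ps) ≤ sum (map ∣_∣ qs)
sum-∣∣-mono {n} ps qs pointwise = begin
  sum (map ∣_∣ ps)                                                   ≡⟨ sum-∣∣≡ ps ⟩
  sum (map (λ z → sum (map (λ p → χ (lookup p z)) ps)) (allFin n))   ≤⟨ sum-map-mono pointwise (allFin n) ⟩
  sum (map (λ z → sum (map (λ q → χ (lookup q z)) qs)) (allFin n))   ≡⟨ sum-∣∣≡ qs ⟨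
  sum (map ∣_∣ qs)                                                   ∎
  where
  open ≤-Reasoning
  sum-∣∣≡ : ∀ rs → sum (map ∣_∣ rs) ≡ sum (map (λ z → sum (map (λ r → χ (lookup r z)) rs)) (allFin n))
  sum-∣∣≡ rs = trans (cong sum (map-cong ∣p∣≡sum-χ rs)) (sum-map-swap (λ r z → χ (lookup r z)) rs (allFin n))

leftCorner : Fin 4 → Bool
leftCorner zero       = true
leftCorner (suc zero) = true
leftCorner _          = false

memX : (w∈C z∈A z∈B z≡ιj z≡w : Bool) → Bool
memX true  a b e f = (a ∨ b) ∧ not (e ∨ f)
memX false a b e f = (a ∧ b) ∨ (e ∨ f)

memX-at-corner : ∀ c a e → memX c a (not a) e false ≡ e xor c
memX-at-corner true  true  true  = refl
memX-at-corner true  true  false = refl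
memX-at-corner true  false true  = refl
memX-at-corner true  false false = refl
memX-at-corner false true  true  = refl
memX-at-corner false true  false = refl
memX-at-corner false false true  = refl
memX-at-corner false false false = refl

memX-edge-at-corner : ∀ a e f → memX false a (not a) e f ≡ e ∨ f
memX-edge-at-corner true  e f = refl
memX-edge-at-corner false e f = refl

memX-at-self : ∀ c a b → memX c a b false true ≡ not c
memX-at-self true  a b = Bool.∧-zeroʳ (a ∨ b)
memX-at-self false a b = Bool.∨-zeroʳ (a ∧ b)

data Atom : Set where
  `x `y : Atom
  `ι    : Fin 4 → Atom

data Expr : Set where
  `A   : Expr
  `⁅_⁆ : Atom → Expr
  `X   : Fin 4 → Atom → Expr
  _`∩_ : Expr → Expr → Expr

-- The type of an element z of [n]: the corner ι k, or, for z ∉ [4] (where z ∈ A ⇔ z ∈ B),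
-- whether z ∈ A ∩ B, whether z = x and whether z = y.
data Point : Set where
  corner : Fin 4 → Point
  other  : (inC isX isY : Bool) → Point

module PointTypes (x∈C y∈C : Bool) where

  inC : Atom → Bool
  inC `x     = x∈C
  inC `y     = y∈C
  inC (`ι _) = false

  inA inB : Point → Bool
  inA (corner k)    = leftCorner k
  inA (other c _ _) = c
  inB (corner k)    = not (leftCorner k)
  inB (other c _ _) = c

  _is_ : Point → Atom → Bool
  corner k     is `ι l = does (l ≟ k)
  other _ ex _ is `x   = ex
  other _ _ ey is `y   = ey
  _            is _    = false

  _∈ₑ_ : Point → Expr → Bool
  p ∈ₑ `A       = inA p
  p ∈ₑ `⁅ w ⁆   = p is w
  p ∈ₑ `X j w   = memX (inC w) (inA p) (inB p) (p is `ι j) (p is w)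
  p ∈ₑ (e `∩ f) = p ∈ₑ e ∧ p ∈ₑ f

  -- apart = true records that x ≢ y; with apart = false the point types also cover y = x.
  Valid : (apart : Bool) → Point → Set
  Valid apart (corner _)      = ⊤
  Valid apart (other c ex ey) = (T ex → c ≡ x∈C) × (T ey → c ≡ y∈C) × (T apart → ¬ (T ex × T ey))

  valid? : ∀ apart → Decidable (Valid apart)
  valid? apart (corner _)      = yes tt
  valid? apart (other c ex ey) =
    (T? ex →-dec c Bool.≟ x∈C) ×-dec (T? ey →-dec c Bool.≟ y∈C) ×-dec (T? apart →-dec ¬? (T? ex ×-dec T? ey))

  PointwiseBound : (apart : Bool) → List Expr → List Expr → Set
  PointwiseBound apart es fs =
    ∀ p → Valid apart p → sum (map (λ e → χ (p ∈ₑ e)) es) ≤ sum (map (λ f → χ (p ∈ₑ f)) fs)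

  -- For lists L, R of singletons with |L| = |R| + 2, |P| + |L| ≤ |A| + |R| says |P| ≤ |A| - 2.
  BelowA : (apart : Bool) → Expr → List Atom × List Atom → Set
  BelowA apart P (L , R) = PointwiseBound apart (P ∷ map `⁅_⁆ L) (`A ∷ map `⁅_⁆ R)

∀-Bool? : ∀ {P : Pred Bool p} → Decidable P → Dec (∀ b → P b)
∀-Bool? P? = map′ (λ { (Pt , Pf) true → Pt ; (Pt , Pf) false → Pf }) (λ ∀P → ∀P true , ∀P false)
                  (P? true ×-dec P? false)

∀-Point? : ∀ {P : Pred Point p} → Decidable P → Dec (∀ p → P p)
∀-Point? P? = map′ (λ { (Pc , Po) (corner k) → Pc k ; (Pc , Po) (other c ex ey) → Po c ex ey })
                   (λ ∀P → (λ k → ∀P (corner k)) , λ c ex ey → ∀P (other c ex ey))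
                   (all? (P? ∘ corner) ×-dec ∀-Bool? λ c → ∀-Bool? λ ex → ∀-Bool? λ ey → P? (other c ex ey))

belowA? : ∀ cx cy apart P c → Dec (PointTypes.BelowA cx cy apart P c)
belowA? cx cy apart P (L , R) = ∀-Point? λ p → valid? apart p →-dec _ ≤? _
  where open PointTypes cx cy

-- Edges of [4] and the certificates

Edge : Set
Edge = Fin 4 × Fin 4

edges : List Edge
edges = (# 0 , # 1) ∷ (# 0 , # 2) ∷ (# 0 , # 3) ∷ (# 1 , # 2) ∷ (# 1 , # 3) ∷ (# 2 , # 3) ∷ []

e₂₄ : Edge
e₂₄ = # 1 , # 3

_∋ᵉ_ : Edge → Fin 4 → Bool
(k , l) ∋ᵉ m = does (k ≟ m) ∨ does (l ≟ m)

G-certificate : Bool → Bool → Fin 4 → Fin 4 → List Atom × List Atom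
G-certificate false false i j = `ι (# 0) ∷ `ι (# 1) ∷ [] , []
G-certificate false true  i j = `ι (# 0) ∷ `ι (# 1) ∷ `y ∷ [] , `ι i ∷ []
G-certificate true  false i j = `ι (# 0) ∷ `ι (# 1) ∷ `x ∷ [] , `ι j ∷ []
G-certificate true  true  i j = `ι i ∷ `ι j ∷ `x ∷ `y ∷ [] , `ι (# 2) ∷ `ι (# 3) ∷ []

G-certificate-balanced : ∀ cx cy i j →
  length (proj₁ (G-certificate cx cy i j)) ≡ 2 + length (proj₂ (G-certificate cx cy i j))
G-certificate-balanced false false i j = refl
G-certificate-balanced false true  i j = refl
G-certificate-balanced true  false i j = refl
G-certificate-balanced true  true  i j = refl

G-belowA : ∀ cx cy i j → i ≢ j → PointTypes.BelowA cx cy true (`X j `y `∩ `X i `x) (G-certificate cx cy i j)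
G-belowA = from-yes (∀-Bool? λ cx → ∀-Bool? λ cy → all? λ i → all? λ j →
  ¬? (i ≟ j) →-dec belowA? cx cy true (`X j `y `∩ `X i `x) (G-certificate cx cy i j))

E-certificate : Bool → Fin 4 → Edge → List Atom × List Atom
E-certificate false i e       = `ι (# 0) ∷ `ι (# 1) ∷ [] , []
E-certificate true  i (k , l) = `ι (# 0) ∷ `ι (# 1) ∷ `x ∷ `ι i ∷ [] , `ι k ∷ `ι l ∷ []

E-certificate-balanced : ∀ cx i e → length (proj₁ (E-certificate cx i e)) ≡ 2 + length (proj₂ (E-certificate cx i e))
E-certificate-balanced false i e = refl
E-certificate-balanced true  i e = refl

E-belowA : ∀ cx i k l → (k , l) ∋ᵉ i ≡ cx →
  PointTypes.BelowA cx cx false (`X k (`ι l) `∩ `X i `x) (E-certificate cx i (k , l))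
E-belowA = from-yes (∀-Bool? λ cx → all? λ i → all? λ k → all? λ l →
  ((k , l) ∋ᵉ i Bool.≟ cx) →-dec belowA? cx cx false (`X k (`ι l) `∩ `X i `x) (E-certificate cx i (k , l)))

corner-pattern-determines-index : ∀ c c' j j' → (∀ m → does (j ≟ m) xor c ≡ does (j' ≟ m) xor c') → j ≡ j'
corner-pattern-determines-index = from-yes (∀-Bool? λ c → ∀-Bool? λ c' → all? λ (j : Fin 4) → all? λ j' →
  all? (λ m → does (j ≟ m) xor c Bool.≟ does (j' ≟ m) xor c') →-dec j ≟ j')

Separated : Edge → Edge → Set
Separated e e' = ¬ (∀ m → e ∋ᵉ m ≡ e' ∋ᵉ m)

separated? : ∀ e e' → Dec (Separated e e')
separated? e e' = ¬? (all? λ m → e ∋ᵉ m Bool.≟ e' ∋ᵉ m)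

edges-proper : All (λ e → proj₁ e ≢ proj₂ e) edges
edges-proper = from-yes (All.all? (λ e → ¬? (proj₁ e ≟ proj₂ e)) edges)

edges-separated : AllPairs Separated edges
edges-separated = from-yes (allPairs? separated? edges)

-- The edges whose sets meet X_{i,x} in t - 1 points: through i if x ∈ A ∩ B, avoiding i otherwise.
badEdges : Bool → Fin 4 → List Edge
badEdges c i = filter (λ e → e ∋ᵉ i Bool.≟ c) edges

badEdges-bad : ∀ c i → All (λ e → e ∋ᵉ i ≡ c) (badEdges c i)
badEdges-bad c i = AllP.all-filter (λ e → e ∋ᵉ i Bool.≟ c) edges

badEdges-proper : ∀ c i → All (λ e → proj₁ e ≢ proj₂ e) (badEdges c i)
badEdges-proper c i = AllP.filter⁺ (λ e → e ∋ᵉ i Bool.≟ c) edges-proper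

badEdges-separated : ∀ c i → AllPairs Separated (badEdges c i)
badEdges-separated c i = AllPairsP.filter⁺ (λ e → e ∋ᵉ i Bool.≟ c) edges-separated

badEdges-length : ∀ c i → length (badEdges c i) ≡ 3
badEdges-length = from-yes (∀-Bool? λ c → all? λ i → length (badEdges c i) ℕ.≟ 3)

badEdges₂ : Bool → Fin 4 → List Edge
badEdges₂ c i = filter (λ e → separated? e e₂₄) (badEdges c i)

badEdges₂-bad : ∀ c i → All (λ e → e ∋ᵉ i ≡ c) (badEdges₂ c i)
badEdges₂-bad c i = AllP.filter⁺ (λ e → separated? e e₂₄) (badEdges-bad c i)

badEdges₂-proper : ∀ c i → All (λ e → proj₁ e ≢ proj₂ e × Separated e e₂₄) (badEdges₂ c i)
badEdges₂-proper c i = All.zip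
  ( AllP.filter⁺ (λ e → separated? e e₂₄) (badEdges-proper c i)
  , AllP.all-filter (λ e → separated? e e₂₄) (badEdges c i) )

badEdges₂-separated : ∀ c i → AllPairs Separated (badEdges₂ c i)
badEdges₂-separated c i = AllPairsP.filter⁺ (λ e → separated? e e₂₄) (badEdges-separated c i)

badEdges₂-length : ∀ c i → 2 ≤ length (badEdges₂ c i)
badEdges₂-length = from-yes (∀-Bool? λ c → all? λ i → 2 ≤? length (badEdges₂ c i))

badEdges₂-length-inside : ∀ {i} → i ≡ # 0 ⊎ i ≡ # 2 → length (badEdges₂ true i) ≡ 3
badEdges₂-length-inside (inj₁ refl) = refl
badEdges₂-length-inside (inj₂ refl) = refl

badEdges₂-length-outside : ∀ {i} → i ≡ # 1 ⊎ i ≡ # 3 → length (badEdges₂ false i) ≡ 3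
badEdges₂-length-outside (inj₁ refl) = refl
badEdges₂-length-outside (inj₂ refl) = refl

others : Fin 4 → List (Fin 4)
others i = filter (λ j → ¬? (j ≟ i)) (Vec.toList (Vec.allFin 4))

others-≢ : ∀ i → All (_≢ i) (others i)
others-≢ i = AllP.all-filter (λ j → ¬? (j ≟ i)) (Vec.toList (Vec.allFin 4))

others-distinct : ∀ i → AllPairs _≢_ (others i)
others-distinct i = AllPairsP.filter⁺ (λ j → ¬? (j ≟ i)) (allFin⁺ 4)

∈-others : ∀ {i j} → j ≢ i → j ∈ others i
∈-others {i} {j} j≢i = ∈-filter⁺ (λ j → ¬? (j ≟ i)) (∈-allFin j) j≢i

others-length : ∀ i → length (others i) ≡ 3
others-length = from-yes (all? λ i → length (others i) ℕ.≟ 3)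

-- The configuration A, B

∧-not≡true : ∀ {a b} → a ∧ not b ≡ true → a ≡ true × b ≡ false
∧-not≡true {true} {false} _ = refl , refl

∧-not≡false : ∀ {a b} → a ∧ not b ≡ false → b ∧ not a ≡ false → a ≡ b
∧-not≡false {true}  {true}  _ _ = refl
∧-not≡false {false} {false} _ _ = refl

module Configuration {n : ℕ} (4≤n : 4 ≤ n) (A B : Subset n)
  (A─B : A ─ B ≡ ⁅ Setup.ι 4≤n A B zero ⁆ ∪ ⁅ Setup.ι 4≤n A B (suc zero) ⁆)
  (B─A : B ─ A ≡ ⁅ Setup.ι 4≤n A B (suc (suc zero)) ⁆ ∪ ⁅ Setup.ι 4≤n A B (suc (suc (suc zero))) ⁆)
  where

  open Setup 4≤n A B

  ι-injective : ∀ {k l} → ι k ≡ ι l → k ≡ l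
  ι-injective = inject≤-injective 4≤n 4≤n _ _

  does-ι≟ι : ∀ k l → does (ι k ≟ ι l) ≡ does (k ≟ l)
  does-ι≟ι k l with k ≟ l
  ... | yes refl = dec-true (ι k ≟ ι k) refl
  ... | no  k≢l  = dec-false (ι k ≟ ι l) (k≢l ∘ ι-injective)

  ι≢outside : ∀ {w} → Outside4 w → ∀ k → ι k ≢ w
  ι≢outside w∉4 k refl = <⇒≱ (subst (_< 4) (sym (toℕ-inject≤ k 4≤n)) (toℕ<n k)) w∉4

  does-ι≟outside : ∀ {w} → Outside4 w → ∀ k → does (ι k ≟ w) ≡ false
  does-ι≟outside w∉4 k = dec-false (ι k ≟ _) (ι≢outside w∉4 k)

  A─B-at-corner : ∀ k → lookup A (ι k) ∧ not (lookup B (ι k)) ≡ does (# 0 ≟ k) ∨ does (# 1 ≟ k)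
  A─B-at-corner k =
    trans (lookup-─≡⁅⁆∪⁅⁆ A─B (ι k)) (cong₂ _∨_ (does-ι≟ι (# 0) k) (does-ι≟ι (# 1) k))

  B─A-at-corner : ∀ k → lookup B (ι k) ∧ not (lookup A (ι k)) ≡ does (# 2 ≟ k) ∨ does (# 3 ≟ k)
  B─A-at-corner k =
    trans (lookup-─≡⁅⁆∪⁅⁆ B─A (ι k)) (cong₂ _∨_ (does-ι≟ι (# 2) k) (does-ι≟ι (# 3) k))

  corner-sides : ∀ k → lookup A (ι k) ≡ leftCorner k × lookup B (ι k) ≡ not (leftCorner k)
  corner-sides zero                   = ∧-not≡true (A─B-at-corner zero)
  corner-sides (suc zero)             = ∧-not≡true (A─B-at-corner (suc zero))
  corner-sides (suc (suc zero))       = swap (∧-not≡true (B─A-at-corner (suc (suc zero))))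
  corner-sides (suc (suc (suc zero))) = swap (∧-not≡true (B─A-at-corner (suc (suc (suc zero)))))

  corner-∉C : ∀ k → lookup (A ∩ B) (ι k) ≡ false
  corner-∉C k rewrite lookup-∩ A B (ι k) | proj₁ (corner-sides k) | proj₂ (corner-sides k) =
    Bool.∧-inverseʳ (leftCorner k)

  A≡B-off-corners : ∀ {z} → (∀ k → ι k ≢ z) → lookup A z ≡ lookup B z
  A≡B-off-corners {z} z≢ι = ∧-not≡false
    (trans (lookup-─≡⁅⁆∪⁅⁆ A─B z) (cong₂ _∨_ (not-corner (# 0)) (not-corner (# 1))))
    (trans (lookup-─≡⁅⁆∪⁅⁆ B─A z) (cong₂ _∨_ (not-corner (# 2)) (not-corner (# 3))))
    where
    not-corner : ∀ k → does (ι k ≟ z) ≡ false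
    not-corner k = dec-false (ι k ≟ z) (z≢ι k)

  C≡A-off-corners : ∀ {z} → (∀ k → ι k ≢ z) → lookup (A ∩ B) z ≡ lookup A z
  C≡A-off-corners {z} z≢ι =
    trans (lookup-∩ A B z) (trans (cong (lookup A z ∧_) (sym (A≡B-off-corners z≢ι))) (Bool.∧-idem (lookup A z)))

  lookup-X : ∀ j w z → lookup (X j w) z ≡
             memX (lookup (A ∩ B) w) (lookup A z) (lookup B z) (does (ι j ≟ z)) (does (w ≟ z))
  lookup-X j w z with lookup (A ∩ B) w
  ... | true  = trans (lookup-─ (A ∪ B) _ z)
                      (cong₂ (λ u v → u ∧ not v) (lookup-∪ A B z) (lookup-⁅⁆∪⁅⁆ (ι j) w z))
  ... | false = trans (lookup-∪ (A ∩ B) _ z) (cong₂ _∨_ (lookup-∩ A B z) (lookup-⁅⁆∪⁅⁆ (ι j) w z))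

  X-edge : Edge → Subset n
  X-edge (k , l) = X k (ι l)

  lookup-X-corner : ∀ {w} → Outside4 w → ∀ j m → lookup (X j w) (ι m) ≡ does (j ≟ m) xor lookup (A ∩ B) w
  lookup-X-corner {w} w∉4 j m
    rewrite lookup-X j w (ι m) | proj₁ (corner-sides m) | proj₂ (corner-sides m) | does-ι≟ι j m
          | dec-false (w ≟ ι m) (ι≢outside w∉4 m ∘ sym)
    = memX-at-corner (lookup (A ∩ B) w) (leftCorner m) (does (j ≟ m))

  lookup-X-edge-corner : ∀ e m → lookup (X-edge e) (ι m) ≡ e ∋ᵉ m
  lookup-X-edge-corner (k , l) m
    rewrite lookup-X k (ι l) (ι m) | corner-∉C l | proj₁ (corner-sides m) | proj₂ (corner-sides m)
          | does-ι≟ι k m | does-ι≟ι l m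
    = memX-edge-at-corner (leftCorner m) (does (k ≟ m)) (does (l ≟ m))

  lookup-X-self : ∀ {w} → Outside4 w → ∀ j → lookup (X j w) w ≡ not (lookup (A ∩ B) w)
  lookup-X-self {w} w∉4 j
    rewrite lookup-X j w w | does-ι≟outside w∉4 j | dec-true (w ≟ w) refl
    = memX-at-self (lookup (A ∩ B) w) (lookup A w) (lookup B w)

  lookup-X-edge-outside : ∀ {w} → Outside4 w → ∀ e → lookup (X-edge e) w ≡ lookup (A ∩ B) w
  lookup-X-edge-outside {w} w∉4 (k , l)
    rewrite lookup-X k (ι l) w | corner-∉C l | does-ι≟outside w∉4 k | does-ι≟outside w∉4 l
    = trans (Bool.∨-identityʳ _) (sym (lookup-∩ A B w))

  X-index-injective : ∀ {j j' w w'} → Outside4 w → Outside4 w' → X j w ≡ X j' w' → j ≡ j'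
  X-index-injective {j} {j'} w∉4 w'∉4 X≡X = corner-pattern-determines-index _ _ j j' λ m →
    trans (sym (lookup-X-corner w∉4 j m)) (trans (cong (λ S → lookup S (ι m)) X≡X) (lookup-X-corner w'∉4 j' m))

  X≢X-edge : ∀ {w} → Outside4 w → ∀ j e → X j w ≢ X-edge e
  X≢X-edge {w} w∉4 j e X≡Xᵉ = Bool.not-¬ refl
    (trans (sym (lookup-X-edge-outside w∉4 e)) (trans (cong (λ S → lookup S w) (sym X≡Xᵉ)) (lookup-X-self w∉4 j)))

  X-edge-separated : ∀ {e e'} → Separated e e' → X-edge e ≢ X-edge e'
  X-edge-separated {e} {e'} sep Xᵉ≡Xᵉ = sep λ m →
    trans (sym (lookup-X-edge-corner e m)) (trans (cong (λ S → lookup S (ι m)) Xᵉ≡Xᵉ) (lookup-X-edge-corner e' m))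

  module Realization (x y : Fin n) (x∉4 : Outside4 x) (y∉4 : Outside4 y) (apart : Bool) (x≢y : T apart → x ≢ y) where

    open PointTypes (lookup (A ∩ B) x) (lookup (A ∩ B) y)

    ⟦_⟧ᵃ : Atom → Fin n
    ⟦ `x ⟧ᵃ   = x
    ⟦ `y ⟧ᵃ   = y
    ⟦ `ι k ⟧ᵃ = ι k

    ⟦_⟧ : Expr → Subset n
    ⟦ `A ⟧     = A
    ⟦ `⁅ w ⁆ ⟧ = ⁅ ⟦ w ⟧ᵃ ⁆
    ⟦ `X j w ⟧ = X j ⟦ w ⟧ᵃ
    ⟦ e `∩ f ⟧ = ⟦ e ⟧ ∩ ⟦ f ⟧

    lookup-C-atom : ∀ w → lookup (A ∩ B) ⟦ w ⟧ᵃ ≡ inC w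
    lookup-C-atom `x     = refl
    lookup-C-atom `y     = refl
    lookup-C-atom (`ι k) = corner-∉C k

    record Realizes (z : Fin n) (p : Point) : Set where
      field
        valid : Valid apart p
        in-A  : lookup A z ≡ inA p
        in-B  : lookup B z ≡ inB p
        is-at : ∀ w → does (⟦ w ⟧ᵃ ≟ z) ≡ p is w

    lookup-⟦⟧ : ∀ {z p} → Realizes z p → ∀ e → lookup ⟦ e ⟧ z ≡ p ∈ₑ e
    lookup-⟦⟧     r `A       = Realizes.in-A r
    lookup-⟦⟧ {z} r `⁅ w ⁆   = trans (lookup-⁅⁆ ⟦ w ⟧ᵃ z) (Realizes.is-at r w)
    lookup-⟦⟧ {z} r (`X j w)
      rewrite lookup-X j ⟦ w ⟧ᵃ z | lookup-C-atom w | Realizes.in-A r | Realizes.in-B r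
            | Realizes.is-at r (`ι j) | Realizes.is-at r w = refl
    lookup-⟦⟧ {z} r (e `∩ f) =
      trans (lookup-∩ ⟦ e ⟧ ⟦ f ⟧ z) (cong₂ _∧_ (lookup-⟦⟧ r e) (lookup-⟦⟧ r f))

    realize-corner : ∀ k → Realizes (ι k) (corner k)
    realize-corner k = record
      { valid = tt
      ; in-A  = proj₁ (corner-sides k)
      ; in-B  = proj₂ (corner-sides k)
      ; is-at = λ { `x     → dec-false (x ≟ ι k) (ι≢outside x∉4 k ∘ sym)
                  ; `y     → dec-false (y ≟ ι k) (ι≢outside y∉4 k ∘ sym)
                  ; (`ι l) → does-ι≟ι l k }
      }

    realize-other : ∀ {z} → (∀ k → ι k ≢ z) → Realizes z (other (lookup A z) (does (x ≟ z)) (does (y ≟ z)))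
    realize-other {z} z≢ι = record
      { valid = at-x , at-y , not-both
      ; in-A  = refl
      ; in-B  = sym (A≡B-off-corners z≢ι)
      ; is-at = λ { `x → refl ; `y → refl ; (`ι k) → dec-false (ι k ≟ z) (z≢ι k) }
      }
      where
      at-x : T (does (x ≟ z)) → lookup A z ≡ lookup (A ∩ B) x
      at-x with x ≟ z
      ... | yes refl = λ _ → sym (C≡A-off-corners z≢ι)
      ... | no  _    = λ ()
      at-y : T (does (y ≟ z)) → lookup A z ≡ lookup (A ∩ B) y
      at-y with y ≟ z
      ... | yes refl = λ _ → sym (C≡A-off-corners z≢ι)
      ... | no  _    = λ ()
      not-both : T apart → ¬ (T (does (x ≟ z)) × T (does (y ≟ z)))
      not-both apart with x ≟ z | y ≟ z
      ... | yes refl | yes refl = λ _ → x≢y apart refl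
      ... | yes _    | no  _    = λ ()
      ... | no  _    | _        = λ ()

    realize : ∀ z → ∃ (Realizes z)
    realize z with any? (λ k → ι k ≟ z)
    ... | yes (k , refl) = corner k , realize-corner k
    ... | no  ¬corner    = _ , realize-other (λ k ιk≡z → ¬corner (k , ιk≡z))

    sum-∣⟦⟧∣-mono : ∀ es fs → PointwiseBound apart es fs →
                    sum (map ∣_∣ (map ⟦_⟧ es)) ≤ sum (map ∣_∣ (map ⟦_⟧ fs))
    sum-∣⟦⟧∣-mono es fs bound = sum-∣∣-mono (map ⟦_⟧ es) (map ⟦_⟧ fs) pointwise
      where
      count-at : ∀ {z p} → Realizes z p → ∀ gs →
                 sum (map (λ q → χ (lookup q z)) (map ⟦_⟧ gs)) ≡ sum (map (λ g → χ (p ∈ₑ g)) gs)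
      count-at r []       = refl
      count-at r (g ∷ gs) = cong₂ _+_ (cong χ (lookup-⟦⟧ r g)) (count-at r gs)
      pointwise : ∀ z → sum (map (λ q → χ (lookup q z)) (map ⟦_⟧ es))
                      ≤ sum (map (λ q → χ (lookup q z)) (map ⟦_⟧ fs))
      pointwise z with p , r ← realize z =
        subst₂ _≤_ (sym (count-at r es)) (sym (count-at r fs)) (bound p (Realizes.valid r))

    sum-∣singletons∣ : ∀ ws → sum (map ∣_∣ (map ⟦_⟧ (map `⁅_⁆ ws))) ≡ length ws
    sum-∣singletons∣ []       = refl
    sum-∣singletons∣ (w ∷ ws) = cong₂ _+_ (∣⁅x⁆∣≡1 ⟦ w ⟧ᵃ) (sum-∣singletons∣ ws)

    <t-if-BelowA : ∀ {t} → ∣ A ∣ ≡ suc t → ∀ P c → length (proj₁ c) ≡ 2 + length (proj₂ c) →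
                   BelowA apart P c → ∣ ⟦ P ⟧ ∣ < t
    <t-if-BelowA {t} ∣A∣ P (L , R) balanced below =
      s≤s⁻¹ (+-cancelʳ-≤ (length R) (2 + ∣ ⟦ P ⟧ ∣) (suc t) (begin
        2 + ∣ ⟦ P ⟧ ∣ + length R
          ≡⟨ cong (_+ length R) (+-comm 2 ∣ ⟦ P ⟧ ∣) ⟩
        ∣ ⟦ P ⟧ ∣ + 2 + length R
          ≡⟨ +-assoc ∣ ⟦ P ⟧ ∣ 2 (length R) ⟩
        ∣ ⟦ P ⟧ ∣ + (2 + length R)
          ≡⟨ cong (∣ ⟦ P ⟧ ∣ +_) (trans (sum-∣singletons∣ L) balanced) ⟨
        sum (map ∣_∣ (map ⟦_⟧ (P ∷ map `⁅_⁆ L)))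
          ≤⟨ sum-∣⟦⟧∣-mono (P ∷ map `⁅_⁆ L) (`A ∷ map `⁅_⁆ R) below ⟩
        sum (map ∣_∣ (map ⟦_⟧ (`A ∷ map `⁅_⁆ R)))
          ≡⟨ cong₂ _+_ ∣A∣ (sum-∣singletons∣ R) ⟩
        suc t + length R
          ∎))
      where open ≤-Reasoning

  G-bad : ∀ {t} → ∣ A ∣ ≡ suc t → ∀ {i j x y} → Outside4 x → Outside4 y → i ≢ j → x ≢ y →
          ∣ X j y ∩ X i x ∣ < t
  G-bad ∣A∣ {i} {j} {x} {y} x∉4 y∉4 i≢j x≢y =
    <t-if-BelowA ∣A∣ (`X j `y `∩ `X i `x) (G-certificate cx cy i j) (G-certificate-balanced cx cy i j)
      (G-belowA cx cy i j i≢j)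
    where
    open Realization x y x∉4 y∉4 true (λ _ → x≢y)
    cx = lookup (A ∩ B) x
    cy = lookup (A ∩ B) y

  E-bad : ∀ {t} → ∣ A ∣ ≡ suc t → ∀ {i x} → Outside4 x → ∀ e → e ∋ᵉ i ≡ lookup (A ∩ B) x →
          ∣ X-edge e ∩ X i x ∣ < t
  E-bad ∣A∣ {i} {x} x∉4 (k , l) i∈e≡cx =
    <t-if-BelowA ∣A∣ (`X k (`ι l) `∩ `X i `x) (E-certificate cx i (k , l)) (E-certificate-balanced cx i (k , l))
      (E-belowA cx i k l i∈e≡cx)
    where
    open Realization x x x∉4 x∉4 false (λ ())
    cx = lookup (A ∩ B) x

  OnX : Fin 4 → Fin n → Pred (Subset n) 0ℓ
  OnX i x S = ∃ λ j → ¬ j ≡ i × S ≡ X j x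

  onX? : ∀ i x → Decidable (OnX i x)
  onX? i x S = any? (λ j → ¬? (j ≟ i) ×-dec (S ≟ₛ X j x))

  Bad : ℕ → Fin 4 → Fin n → Pred (Subset n) 0ℓ
  Bad t i x S = ∣ S ∩ X i x ∣ < t

  bad? : ∀ t i x → Decidable (Bad t i x)
  bad? t i x S = ∣ S ∩ X i x ∣ <? t

  Block : Fin 4 ⊎ Edge → Pred (Subset n) 0ℓ
  Block (inj₁ j) S = ∃ λ y → Outside4 y × S ≡ X j y
  Block (inj₂ e) S = X-edge e ≡ S

  block? : ∀ k → Decidable (Block k)
  block? (inj₁ j) S = any? (λ y → (4 ≤? toℕ y) ×-dec (S ≟ₛ X j y))
  block? (inj₂ e) S = X-edge e ≟ₛ S

  blocks-disjoint : ∀ i {es} → AllPairs Separated es →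
                    AllPairs (λ k l → Block k ⊥ Block l) (map inj₁ (others i) ++ map inj₂ es)
  blocks-disjoint i es-separated = AllPairsP.++⁺
    (AllPairsP.map⁺ (AllPairs.map G⊥G (others-distinct i)))
    (AllPairsP.map⁺ (AllPairs.map E⊥E es-separated))
    (AllP.map⁺ (All.universal (λ j → AllP.map⁺ (All.universal (G⊥E j) _)) _))
    where
    G⊥G : ∀ {j j'} → j ≢ j' → Block (inj₁ j) ⊥ Block (inj₁ j')
    G⊥G j≢j' ((y , y∉4 , S≡Xjy) , (y' , y'∉4 , S≡Xj'y')) =
      j≢j' (X-index-injective y∉4 y'∉4 (trans (sym S≡Xjy) S≡Xj'y'))
    G⊥E : ∀ j e → Block (inj₁ j) ⊥ Block (inj₂ e)
    G⊥E j e ((y , y∉4 , S≡Xjy) , Xe≡S) = X≢X-edge y∉4 j e (trans (sym S≡Xjy) (sym Xe≡S))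
    E⊥E : ∀ {e e'} → Separated e e' → Block (inj₂ e) ⊥ Block (inj₂ e')
    E⊥E sep (Xe≡S , Xe'≡S) = X-edge-separated sep (trans Xe≡S (sym Xe'≡S))

  blocks-covered : ∀ {t} → ∣ A ∣ ≡ suc t → ∀ {i x} → Outside4 x →
                   ∀ {es} → All (λ e → e ∋ᵉ i ≡ lookup (A ∩ B) x) es →
                   All (λ k → Block k U.⊆ (OnX i x U.∪ Bad t i x)) (map inj₁ (others i) ++ map inj₂ es)
  blocks-covered ∣A∣ {i} {x} x∉4 es-bad =
    AllP.++⁺ (AllP.map⁺ (All.map G-covered (others-≢ i))) (AllP.map⁺ (All.map E-covered es-bad))
    where
    G-covered : ∀ {j} → j ≢ i → Block (inj₁ j) U.⊆ (OnX i x U.∪ Bad _ i x)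
    G-covered {j} j≢i (y , y∉4 , S≡Xjy) with y ≟ x
    ... | yes refl = inj₁ (j , j≢i , S≡Xjy)
    ... | no  y≢x  = inj₂ (subst (Bad _ i x) (sym S≡Xjy) (G-bad ∣A∣ x∉4 y∉4 (j≢i ∘ sym) (y≢x ∘ sym)))
    E-covered : ∀ {e} → e ∋ᵉ i ≡ lookup (A ∩ B) x → Block (inj₂ e) U.⊆ (OnX i x U.∪ Bad _ i x)
    E-covered {e} bad refl = inj₂ (E-bad ∣A∣ x∉4 e bad)

  sumOthers+edges≤ : ∀ {t s 𝓕} → ∣ A ∣ ≡ suc t → AlmostIntersecting s t 𝓕 →
    ∀ {i x} → Outside4 x → X i x ∈ₗ 𝓕 → ∀ es → All (λ e → X-edge e ∈ₗ 𝓕) es →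
    All (λ e → e ∋ᵉ i ≡ lookup (A ∩ B) x) es → AllPairs Separated es →
    sumOthers 𝓕 i + length es ≤ s + countX 𝓕 i x
  sumOthers+edges≤ {t} {s} {𝓕} ∣A∣ almost {i} {x} x∉4 Xix∈𝓕 es es∈𝓕 es-bad es-separated = begin
    sumOthers 𝓕 i + length es
      ≤⟨ +-monoʳ-≤ (sumOthers 𝓕 i) (length≤sum-map (All.map (filter-some (_ ≟ₛ_)) es∈𝓕)) ⟩
    sumOthers 𝓕 i + sum (map (count ∘ inj₂) es)
      ≡⟨ sum-blocks ⟨
    sum (map count (map inj₁ (others i) ++ map inj₂ es))
      ≤⟨ Σcount≤count-disjoint block? (onX? i x ∪? bad? t i x)
           (blocks-disjoint i es-separated) (blocks-covered ∣A∣ x∉4 es-bad) 𝓕 ⟩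
    length (filter (onX? i x ∪? bad? t i x) 𝓕)
      ≤⟨ length-filter-∪ (onX? i x) (bad? t i x) 𝓕 ⟩
    countX 𝓕 i x + badCount t 𝓕 (X i x)
      ≤⟨ +-monoʳ-≤ (countX 𝓕 i x) (almost Xix∈𝓕) ⟩
    countX 𝓕 i x + s
      ≡⟨ +-comm (countX 𝓕 i x) s ⟩
    s + countX 𝓕 i x
      ∎
    where
    open ≤-Reasoning
    count : Fin 4 ⊎ Edge → ℕ
    count k = length (filter (block? k) 𝓕)
    sum-blocks : sum (map count (map inj₁ (others i) ++ map inj₂ es)) ≡ sumOthers 𝓕 i + sum (map (count ∘ inj₂) es)
    sum-blocks = begin-equality
      sum (map count (map inj₁ (others i) ++ map inj₂ es))
        ≡⟨ cong sum (map-++ count (map inj₁ (others i)) (map inj₂ es)) ⟩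
      sum (map count (map inj₁ (others i)) ++ map count (map inj₂ es))
        ≡⟨ sum-++ (map count (map inj₁ (others i))) _ ⟩
      sum (map count (map inj₁ (others i))) + sum (map count (map inj₂ es))
        ≡⟨ cong₂ _+_ (cong sum (map-∘ (others i))) (cong sum (map-∘ es)) ⟨
      sumOthers 𝓕 i + sum (map (count ∘ inj₂) es)
        ∎

  countX≤3 : ∀ {𝓕} → Unique 𝓕 → ∀ i x → countX 𝓕 i x ≤ 3
  countX≤3 {𝓕} unique i x = begin
    countX 𝓕 i x
      ≤⟨ count≤Σcount-cover (λ j → X j x ≟ₛ_) (onX? i x) covered 𝓕 ⟩
    sum (map (λ j → length (filter (X j x ≟ₛ_) 𝓕)) (others i))
      ≤⟨ sum-map≤length (λ j → unique⇒count≡≤1 _≟ₛ_ unique (X j x)) (others i) ⟩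
    length (others i)
      ≡⟨ others-length i ⟩
    3 ∎
    where
    open ≤-Reasoning
    covered : OnX i x U.⊆ (λ S → Any (λ j → X j x ≡ S) (others i))
    covered (j , j≢i , S≡Xjx) = Any.map (λ { refl → sym S≡Xjx }) (∈-others j≢i)

  InI⇒three-badEdges₂ : ∀ {i x} → InI i x → length (badEdges₂ (lookup (A ∩ B) x) i) ≡ 3
  InI⇒three-badEdges₂ (inj₁ (i∈02 , x∈C)) rewrite []=⇒lookup x∈C = badEdges₂-length-inside i∈02
  InI⇒three-badEdges₂ (inj₂ (i∈13 , x∉A∪B)) rewrite ∉p∪q⇒lookup-p∩q≡false A B x∉A∪B =
    badEdges₂-length-outside i∈13

  sumOthers-bound-all-edges : ∀ {t s 𝓕} → ∣ A ∣ ≡ suc t → AlmostIntersecting s t 𝓕 → Unique 𝓕 →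
    (∀ k l → k ≢ l → X k (ι l) ∈ₗ 𝓕) → ∀ i x → Outside4 x → X i x ∈ₗ 𝓕 →
    (sumOthers 𝓕 i + 3 ≤ s + countX 𝓕 i x) × (s + countX 𝓕 i x ≤ s + 3)
  sumOthers-bound-all-edges {s = s} {𝓕} ∣A∣ almost unique 𝓔⊆𝓕 i x x∉4 Xix∈𝓕 =
    subst (λ m → sumOthers 𝓕 i + m ≤ s + countX 𝓕 i x) (badEdges-length cx i)
      (sumOthers+edges≤ ∣A∣ almost x∉4 Xix∈𝓕 (badEdges cx i)
        (All.map (λ { {k , l} → 𝓔⊆𝓕 k l }) (badEdges-proper cx i)) (badEdges-bad cx i) (badEdges-separated cx i))
    , +-monoʳ-≤ s (countX≤3 unique i x)
    where cx = lookup (A ∩ B) x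

  sumOthers-bound-all-edges-but-e₂₄ : ∀ {t s 𝓕} → ∣ A ∣ ≡ suc t → AlmostIntersecting s t 𝓕 →
    (∀ k l → k ≢ l → (X k (ι l) ∈ₗ 𝓕 ⇔ X k (ι l) ≢ X (suc zero) (ι (suc (suc (suc zero)))))) →
    ∀ i x → Outside4 x → X i x ∈ₗ 𝓕 →
    (sumOthers 𝓕 i + 2 ≤ s + countX 𝓕 i x) × (InI i x → sumOthers 𝓕 i + 3 ≤ s + countX 𝓕 i x)
  sumOthers-bound-all-edges-but-e₂₄ {s = s} {𝓕} ∣A∣ almost 𝓔∖e₂₄⊆𝓕 i x x∉4 Xix∈𝓕 =
    ≤-trans (+-monoʳ-≤ (sumOthers 𝓕 i) (badEdges₂-length cx i)) bound ,
    λ inI → subst (λ m → sumOthers 𝓕 i + m ≤ s + countX 𝓕 i x) (InI⇒three-badEdges₂ inI) bound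
    where
    cx = lookup (A ∩ B) x
    bound : sumOthers 𝓕 i + length (badEdges₂ cx i) ≤ s + countX 𝓕 i x
    bound = sumOthers+edges≤ ∣A∣ almost x∉4 Xix∈𝓕 (badEdges₂ cx i)
      (All.map (λ { {k , l} (k≢l , sep) → Equivalence.from (𝓔∖e₂₄⊆𝓕 k l k≢l) (X-edge-separated sep) })
        (badEdges₂-proper cx i))
      (badEdges₂-bad cx i) (badEdges₂-separated cx i)

lemma6p5 : (n t s : ℕ) (ht : 1 ≤ t) (hs : 1 ≤ s) (hn : t + s + 2 ≤ n)
    (𝓕 : List (Subset n)) → MaxAdmissible n t s 𝓕 →
    (A B : Subset n) → A ∈ₗ 𝓕 → B ∈ₗ 𝓕 →
    let open Setup (four≤n ht hs hn) A B in
    A ─ B ≡ ⁅ ι zero ⁆ ∪ ⁅ ι (suc zero) ⁆ →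
    B ─ A ≡ ⁅ ι (suc (suc zero)) ⁆ ∪ ⁅ ι (suc (suc (suc zero))) ⁆ →
    -- (i)  𝓕 ∩ 𝓔 = 𝓔
    ((∀ (i j : Fin 4) → i ≢ j → X i (ι j) ∈ₗ 𝓕) →
      ∀ (i : Fin 4) (x : Fin n) → Outside4 x → X i x ∈ₗ 𝓕 →
        (sumOthers 𝓕 i + 3 ≤ s + countX 𝓕 i x) × (s + countX 𝓕 i x ≤ s + 3))
    ×
    -- (ii) 𝓕 ∩ 𝓔 = 𝓔 ∖ {X_{2,4}}
    ((∀ (i j : Fin 4) → i ≢ j →
        (X i (ι j) ∈ₗ 𝓕 ⇔ X i (ι j) ≢ X (suc zero) (ι (suc (suc (suc zero)))))) →
      ∀ (i : Fin 4) (x : Fin n) → Outside4 x → X i x ∈ₗ 𝓕 →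
        (sumOthers 𝓕 i + 2 ≤ s + countX 𝓕 i x)
        × (InI i x → sumOthers 𝓕 i + 3 ≤ s + countX 𝓕 i x))
lemma6p5 n t s ht hs hn 𝓕 ((unique , sizes , almost , _) , _) A B A∈𝓕 _ A─B B─A =
  sumOthers-bound-all-edges ∣A∣ almost unique , sumOthers-bound-all-edges-but-e₂₄ ∣A∣ almost
  where
  open Configuration (four≤n ht hs hn) A B A─B B─A
  ∣A∣ : ∣ A ∣ ≡ suc t
  ∣A∣ = All.lookup sizes A∈𝓕
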